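{- Every term is strongly normalizing: there is no infinite sequence of one-step reductions $t_0\to t_1\to t_2\to\cdots$ starting from a term $t_0$.
   Context: Pseudo-terms are given by the grammar $t ::= x \mid \lambda x.t \mid (t\,t') \mid\, !t \mid \mathrm{let}\ t\ \mathrm{be}\ !x\ \mathrm{in}\ t'$. In $\mathrm{let}\ u\ \mathrm{be}\ !x\ \mathrm{in}\ t_1$ the variable $x$ is bound in $t_1$: $FV(\mathrm{let}\ u\ \mathrm{be}\ !x\ \mathrm{in}\ t_1)=FV(u)\cup(FV(t_1)\setminus\{x\})$; $\lambda$ binds as usual. $FV(t)$ is the set of free variables of $t$, and $no(x,t)$ is the number of free occurrences of $x$ in $t$. Terms and their sets of temporary variables $TV(t)\subseteq FV(t)$ are defined simultaneously as the smallest set of pseudo-terms such that: (i) a variable $x$ is a term, $TV(x)=\emptyset$; (ii) $\lambda x.t$ is a term iff $t$ is a term, $x\notin TV(t)$ and $no(x,t)\le 1$, and then $TV(\lambda x.t)=TV(t)$; (iii) $(t_1\,t_2)$ is a term iff $t_1,t_2$ are terms, $TV(t_1)\cap FV(t_2)=\emptyset$ and $FV(t_1)\cap TV(t_2)=\emptyset$, and then $TV(t_1\,t_2)=TV(t_1)\cup TV(t_2)$; (iv) $!t$ is a term iff $t$ is a term, $TV(t)=\emptyset$ and $no(x,t)=1$ for all $x\in FV(t)$, and then $TV(!t)=FV(t)$; (v) $\mathrm{let}\ t_1\ \mathrm{be}\ !x\ \mathrm{in}\ t_2$ is a term iff $t_1,t_2$ are terms, $TV(t_1)\cap FV(t_2)=\emptyset$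 and $FV(t_1)\cap TV(t_2)=\emptyset$, and then its $TV$ is $TV(t_1)\cup(TV(t_2)\setminus\{x\})$. One-step reduction $\to$ is the contextual closure of the rules: $(\beta)$ $((\lambda x.t)\,u)\to t[u/x]$; (bang) $\mathrm{let}\ !u\ \mathrm{be}\ !x\ \mathrm{in}\ t\to t[u/x]$; (com1) $\mathrm{let}\ (\mathrm{let}\ t_1\ \mathrm{be}\ !y\ \mathrm{in}\ t_2)\ \mathrm{be}\ !x\ \mathrm{in}\ t_3 \to \mathrm{let}\ t_1\ \mathrm{be}\ !y\ \mathrm{in}\ (\mathrm{let}\ t_2\ \mathrm{be}\ !x\ \mathrm{in}\ t_3)$; (com2) $((\mathrm{let}\ t_1\ \mathrm{be}\ !x\ \mathrm{in}\ t_2)\ t_3)\to \mathrm{let}\ t_1\ \mathrm{be}\ !x\ \mathrm{in}\ (t_2\,t_3)$. Here $t[u/x]$ denotes capture-avoiding substitution. -}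

module Defs where

-- Pseudo-terms of the paper, represented with de Bruijn indices
-- (i.e. named terms taken up to alpha-conversion).

open import Data.Nat using (ℕ; zero; suc; _+_; _≤_; _<_)
open import Data.Nat.Properties using (_≟_)
open import Data.Empty using (⊥)
open import Data.Sum using (_⊎_)
open import Data.Product using (Σ; _×_)
open import Relation.Nullary using (¬_; yes; no)
open import Relation.Binary.PropositionalEquality using (_≡_)

-- t ::= x | λx.t | (t t') | !t | let t be !x in t'
-- In 'letb u t' (= let u be !x in t) the body t is under the binder x (index 0).
data Tm : Set where
  var  : ℕ → Tm
  lam  : Tm → Tm
  app  : Tm → Tm → Tm
  bang : Tm → Tm
  letb : Tm → Tm → Tm

occ : ℕ → Tm → ℕ
occ x (var y) with x ≟ y
... | yes _ = 1
... | no  _ = 0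
occ x (lam t)    = occ (suc x) t
occ x (app t u)  = occ x t + occ x u
occ x (bang t)   = occ x t
occ x (letb u t) = occ x u + occ (suc x) t

_∈FV_ : ℕ → Tm → Set
x ∈FV t = 0 < occ x t

_∈TV_ : ℕ → Tm → Set
x ∈TV var y    = ⊥
x ∈TV lam t    = suc x ∈TV t
x ∈TV app t u  = x ∈TV t ⊎ x ∈TV u
x ∈TV bang t   = x ∈FV t
x ∈TV letb u t = x ∈TV u ⊎ suc x ∈TV t

data IsTerm : Tm → Set where
  var  : ∀ x → IsTerm (var x)
  lam  : ∀ {t} → IsTerm t → ¬ (0 ∈TV t) → occ 0 t ≤ 1 → IsTerm (lam t)
  app  : ∀ {t₁ t₂} → IsTerm t₁ → IsTerm t₂
       → (∀ x → x ∈TV t₁ → ¬ (x ∈FV t₂))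
       → (∀ x → x ∈FV t₁ → ¬ (x ∈TV t₂))
       → IsTerm (app t₁ t₂)
  bang : ∀ {t} → IsTerm t
       → (∀ x → ¬ (x ∈TV t))
       → (∀ x → x ∈FV t → occ x t ≡ 1)
       → IsTerm (bang t)
  letb : ∀ {t₁ t₂} → IsTerm t₁ → IsTerm t₂
       -- TV(t₁) ∩ FV(t₂) = ∅ and FV(t₁) ∩ TV(t₂) = ∅, where the bound
       -- variable x of t₂ is (by alpha-conversion) distinct from those of t₁
       → (∀ x → x ∈TV t₁ → ¬ (suc x ∈FV t₂))
       → (∀ x → x ∈FV t₁ → ¬ (suc x ∈TV t₂))
       → IsTerm (letb t₁ t₂)

ext : (ℕ → ℕ) → ℕ → ℕ
ext ρ zero    = zero
ext ρ (suc n) = suc (ρ n)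

rename : (ℕ → ℕ) → Tm → Tm
rename ρ (var x)    = var (ρ x)
rename ρ (lam t)    = lam (rename (ext ρ) t)
rename ρ (app t u)  = app (rename ρ t) (rename ρ u)
rename ρ (bang t)   = bang (rename ρ t)
rename ρ (letb u t) = letb (rename ρ u) (rename (ext ρ) t)

exts : (ℕ → Tm) → ℕ → Tm
exts σ zero    = var zero
exts σ (suc n) = rename suc (σ n)

subst : (ℕ → Tm) → Tm → Tm
subst σ (var x)    = σ x
subst σ (lam t)    = lam (subst (exts σ) t)
subst σ (app t u)  = app (subst σ t) (subst σ u)
subst σ (bang t)   = bang (subst σ t)
subst σ (letb u t) = letb (subst σ u) (subst (exts σ) t)

sub0 : Tm → ℕ → Tm
sub0 u zero    = u
sub0 u (suc n) = var n

_[_] : Tm → Tm → Tm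
t [ u ] = subst (sub0 u) t

infix 4 _⟶_

data _⟶_ : Tm → Tm → Set where
  β     : ∀ {t u} → app (lam t) u ⟶ t [ u ]
  bangr : ∀ {u t} → letb (bang u) t ⟶ t [ u ]
  com1  : ∀ {t₁ t₂ t₃} →
          letb (letb t₁ t₂) t₃ ⟶ letb t₁ (letb t₂ (rename (ext suc) t₃))
  com2  : ∀ {t₁ t₂ t₃} →
          app (letb t₁ t₂) t₃ ⟶ letb t₁ (app t₂ (rename suc t₃))
  ξlam   : ∀ {t t'} → t ⟶ t' → lam t ⟶ lam t'
  ξappl  : ∀ {t t' u} → t ⟶ t' → app t u ⟶ app t' u
  ξappr  : ∀ {t u u'} → u ⟶ u' → app t u ⟶ app t u'
  ξbang  : ∀ {t t'} → t ⟶ t' → bang t ⟶ bang t'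
  ξletl  : ∀ {u u' t} → u ⟶ u' → letb u t ⟶ letb u' t
  ξletr  : ∀ {u t t'} → t ⟶ t' → letb u t ⟶ letb u t'

InfiniteReductionFrom : Tm → Set
InfiniteReductionFrom t =
  Σ (ℕ → Tm) (λ f → (f 0 ≡ t) × (∀ n → f n ⟶ f (suc n)))

module Submission where

-- A term is stratified: a λ-bound variable occurs at most once and under no box, and a
-- let-bound variable either occurs under no box at all, or exactly once and under exactly one
-- box.  Reduction preserves stratification.  On stratified terms every step decreases, in the
-- lexicographic order, the vector whose entries are the numbers of nodes under d boxes, for d
-- from the maximal depth down to 0, followed by a weight that doubles the left operand of
-- application and let.  A β-step deletes nodes at depth 0 and copies nothing below.  Opening a
-- box for a variable that occurs once inside a box deletes that occurrence at depth 1 and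
-- leaves deeper levels alone.  Opening it for a variable that occurs only at depth 0 moves the
-- contents of the box one level up, possibly in many copies, which empties the deepest level
-- they occupied.  The commutations keep every level and decrease the weight.  Sizes and
-- occurrences after a substitution t[u] are both computed by one lemma: the depth profile of
-- t[u] is that of t plus the convolution of the occurrence profile of the substituted variable
-- with the profile of u.

open import Data.Nat
open import Data.Nat.Induction using () renaming (<-wellFounded to <-wellFounded-ℕ)
open import Data.Nat.Properties
open import Algebra.Properties.CommutativeSemigroup +-commutativeSemigroup using (interchange)
open import Data.Nat.Tactic.RingSolver using (solve-∀)
open import Data.Product using (_×_; _,_; proj₁; proj₂; ∃-syntax)
open import Data.Sum using (_⊎_; inj₁; inj₂)
open import Data.Vec using (Vec; []; _∷_)
open import Data.Vec.Relation.Binary.Lex.Strict using (Lex-<; this; next; <-wellFounded)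
open import Defs
open import Function using (_∘_; const)
open import Induction.InfiniteDescent
  using (InfiniteDescendingSequence; InfiniteDescendingSequenceFrom; Descent; descent∧wf⇒empty)
open import Induction.WellFounded using (WellFounded)
open import Relation.Binary using (_Preserves_⟶_)
open import Relation.Binary.PropositionalEquality hiding ([_]; subst)
open import Relation.Nullary using (¬_; Dec; yes; no; contradiction)
open import Relation.Nullary.Decidable using (_⊎-dec_)

-- Profiles and their convolution

-- A profile is indexed by box depth, the number of ! above a position.
Profile : Set
Profile = ℕ → ℕ

infixr 5 _∷ᶠ_
infixl 6 _⊕_
infixl 7 _·_ _⋆_

_∷ᶠ_ : ℕ → (ℕ → ℕ) → ℕ → ℕ
(a ∷ᶠ f) zero    = a
(a ∷ᶠ f) (suc n) = f n

0ᶠ : Profile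
0ᶠ _ = 0

[_]₀ : ℕ → Profile
[ a ]₀ = a ∷ᶠ 0ᶠ

_⊕_ : Profile → Profile → Profile
(f ⊕ g) d = f d + g d

_·_ : ℕ → Profile → Profile
(c · g) d = c * g d

_⋆_ : Profile → Profile → Profile
(f ⋆ g) zero    = f 0 * g 0
(f ⋆ g) (suc d) = f 0 * g (suc d) + (f ∘ suc ⋆ g) d

∷ᶠ-cong : ∀ a {f g} → f ≗ g → a ∷ᶠ f ≗ a ∷ᶠ g
∷ᶠ-cong a f≗g zero    = refl
∷ᶠ-cong a f≗g (suc n) = f≗g n

∷ᶠ-zero : ∀ {w} → w ≗ 0ᶠ → 0 ∷ᶠ w ≗ 0ᶠ
∷ᶠ-zero w≗0 zero    = refl
∷ᶠ-zero w≗0 (suc d) = w≗0 d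

const-∷ᶠ : ∀ a → const a ≗ a ∷ᶠ const a
const-∷ᶠ a zero    = refl
const-∷ᶠ a (suc y) = refl

[0]≗0ᶠ : [ 0 ]₀ ≗ 0ᶠ
[0]≗0ᶠ zero    = refl
[0]≗0ᶠ (suc d) = refl

[0]-+ : ∀ d n → [ 0 ]₀ d + n ≡ n
[0]-+ d n = cong (_+ n) ([0]≗0ᶠ d)

·-[1] : ∀ c → c · [ 1 ]₀ ≗ [ c ]₀
·-[1] c zero    = *-identityʳ c
·-[1] c (suc d) = *-zeroʳ c

⋆-cong : ∀ {f f′ g g′} → f ≗ f′ → g ≗ g′ → f ⋆ g ≗ f′ ⋆ g′
⋆-cong f≗f′ g≗g′ zero    = cong₂ _*_ (f≗f′ 0) (g≗g′ 0)
⋆-cong f≗f′ g≗g′ (suc d) =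
  cong₂ _+_ (cong₂ _*_ (f≗f′ 0) (g≗g′ (suc d))) (⋆-cong (f≗f′ ∘ suc) g≗g′ d)

⋆-zeroˡ : ∀ g → 0ᶠ ⋆ g ≗ 0ᶠ
⋆-zeroˡ g zero    = refl
⋆-zeroˡ g (suc d) = ⋆-zeroˡ g d

⋆-zeroʳ : ∀ f → f ⋆ 0ᶠ ≗ 0ᶠ
⋆-zeroʳ f zero    = *-zeroʳ (f 0)
⋆-zeroʳ f (suc d) = cong₂ _+_ (*-zeroʳ (f 0)) (⋆-zeroʳ (f ∘ suc) d)

[]-⋆ : ∀ c g → [ c ]₀ ⋆ g ≗ c · g
[]-⋆ c g zero    = refl
[]-⋆ c g (suc d) = trans (cong (c * g (suc d) +_) (⋆-zeroˡ g d)) (+-identityʳ _)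

[1]-⋆ : ∀ g → [ 1 ]₀ ⋆ g ≗ g
[1]-⋆ g d = trans ([]-⋆ 1 g d) (*-identityˡ (g d))

⋆-distribʳ-⊕ : ∀ f h g → (f ⊕ h) ⋆ g ≗ f ⋆ g ⊕ h ⋆ g
⋆-distribʳ-⊕ f h g zero    = *-distribʳ-+ (g 0) (f 0) (h 0)
⋆-distribʳ-⊕ f h g (suc d) = begin
  (f 0 + h 0) * g (suc d) + ((f ∘ suc ⊕ h ∘ suc) ⋆ g) d
    ≡⟨ cong₂ _+_ (*-distribʳ-+ (g (suc d)) (f 0) (h 0)) (⋆-distribʳ-⊕ (f ∘ suc) (h ∘ suc) g d) ⟩
  (f 0 * g (suc d) + h 0 * g (suc d)) + ((f ∘ suc ⋆ g) d + (h ∘ suc ⋆ g) d)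
    ≡⟨ interchange (f 0 * g (suc d)) (h 0 * g (suc d)) _ _ ⟩
  (f ⋆ g) (suc d) + (h ⋆ g) (suc d) ∎
  where open ≡-Reasoning

-- Weighted counts and the substitution lemma

δ : ℕ → ℕ → ℕ
δ x y = occ x (var y)

δ-self : ∀ x → δ x x ≡ 1
δ-self x with x ≟ x
... | yes _  = refl
... | no x≢x = contradiction refl x≢x

δ-other : ∀ {x y} → x ≢ y → δ x y ≡ 0
δ-other {x} {y} x≢y with x ≟ y
... | yes x≡y = contradiction x≡y x≢y
... | no _    = refl

δ-suc : ∀ x → δ (suc x) ≗ 0 ∷ᶠ δ x
δ-suc x zero    = refl
δ-suc x (suc y) with x ≟ y
... | yes refl = δ-self (suc x)
... | no x≢y   = δ-other (x≢y ∘ suc-injective)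

occAt : ℕ → Tm → Profile
occAt x (var y)    = [ δ x y ]₀
occAt x (lam t)    = occAt (suc x) t
occAt x (app t u)  = occAt x t ⊕ occAt x u
occAt x (bang t)   = 0 ∷ᶠ occAt x t
occAt x (letb u t) = occAt x u ⊕ occAt (suc x) t

-- Every node and bound variable weighs a, a free variable y weighs w y.  Sizes
-- (a = 1, w = const 1) and occurrence profiles (a = 0, w = δ x) are both counts.
count : ℕ → (ℕ → ℕ) → Tm → Profile
count a w (var y)    = [ w y ]₀
count a w (lam t)    = [ a ]₀ ⊕ count a (a ∷ᶠ w) t
count a w (app t u)  = [ a ]₀ ⊕ (count a w t ⊕ count a w u)
count a w (bang t)   = a ∷ᶠ count a w t
count a w (letb u t) = [ a ]₀ ⊕ (count a w u ⊕ count a (a ∷ᶠ w) t)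

count-cong : ∀ a {w v} → w ≗ v → ∀ t → count a w t ≗ count a v t
count-cong a w≗v (var y)    d = cong (λ n → [ n ]₀ d) (w≗v y)
count-cong a w≗v (lam t)    d = cong ([ a ]₀ d +_) (count-cong a (∷ᶠ-cong a w≗v) t d)
count-cong a w≗v (app t u)  d =
  cong ([ a ]₀ d +_) (cong₂ _+_ (count-cong a w≗v t d) (count-cong a w≗v u d))
count-cong a w≗v (bang t)   d = ∷ᶠ-cong a (count-cong a w≗v t) d
count-cong a w≗v (letb u t) d =
  cong ([ a ]₀ d +_) (cong₂ _+_ (count-cong a w≗v u d) (count-cong a (∷ᶠ-cong a w≗v) t d))

∷ᶠ-ext : ∀ a w ρ → (a ∷ᶠ w) ∘ ext ρ ≗ a ∷ᶠ (w ∘ ρ)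
∷ᶠ-ext a w ρ zero    = refl
∷ᶠ-ext a w ρ (suc y) = refl

count-rename : ∀ a w ρ t → count a w (rename ρ t) ≗ count a (w ∘ ρ) t
count-rename a w ρ (var y)    d = refl
count-rename a w ρ (lam t)    d = cong ([ a ]₀ d +_)
  (trans (count-rename a (a ∷ᶠ w) (ext ρ) t d) (count-cong a (∷ᶠ-ext a w ρ) t d))
count-rename a w ρ (app t u)  d =
  cong ([ a ]₀ d +_) (cong₂ _+_ (count-rename a w ρ t d) (count-rename a w ρ u d))
count-rename a w ρ (bang t)   d = ∷ᶠ-cong a (count-rename a w ρ t) d
count-rename a w ρ (letb u t) d = cong ([ a ]₀ d +_) (cong₂ _+_ (count-rename a w ρ u d)
  (trans (count-rename a (a ∷ᶠ w) (ext ρ) t d) (count-cong a (∷ᶠ-ext a w ρ) t d)))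

count-zero : ∀ {w} → w ≗ 0ᶠ → ∀ t → count 0 w t ≗ 0ᶠ
count-zero w≗0 (var y)    d = trans (cong (λ n → [ n ]₀ d) (w≗0 y)) ([0]≗0ᶠ d)
count-zero w≗0 (lam t)    d = cong₂ _+_ ([0]≗0ᶠ d) (count-zero (∷ᶠ-zero w≗0) t d)
count-zero w≗0 (app t u)  d =
  cong₂ _+_ ([0]≗0ᶠ d) (cong₂ _+_ (count-zero w≗0 t d) (count-zero w≗0 u d))
count-zero w≗0 (bang t)   d = ∷ᶠ-zero (count-zero w≗0 t) d
count-zero w≗0 (letb u t) d =
  cong₂ _+_ ([0]≗0ᶠ d) (cong₂ _+_ (count-zero w≗0 u d) (count-zero (∷ᶠ-zero w≗0) t d))

occAt-as-count     : ∀ x t → occAt x t ≗ count 0 (δ x) t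
occAt-suc-as-count : ∀ x t → occAt (suc x) t ≗ count 0 (0 ∷ᶠ δ x) t

occAt-as-count x (var y)    d = refl
occAt-as-count x (lam t)    d = trans (occAt-suc-as-count x t d) (sym ([0]-+ d _))
occAt-as-count x (app t u)  d =
  trans (cong₂ _+_ (occAt-as-count x t d) (occAt-as-count x u d)) (sym ([0]-+ d _))
occAt-as-count x (bang t)   d = ∷ᶠ-cong 0 (occAt-as-count x t) d
occAt-as-count x (letb u t) d =
  trans (cong₂ _+_ (occAt-as-count x u d) (occAt-suc-as-count x t d)) (sym ([0]-+ d _))

occAt-suc-as-count x t d = trans (occAt-as-count (suc x) t d) (count-cong 0 (δ-suc x) t d)

SubstitutesAt : ℕ → (ℕ → ℕ) → (ℕ → ℕ) → (ℕ → Tm) → ℕ → Set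
SubstitutesAt a w w′ σ x₀ = ∀ y → y ≢ x₀ → count a w (σ y) ≗ [ w′ y ]₀

SubstitutesAt-exts : ∀ {a w w′ σ x₀} → SubstitutesAt a w w′ σ x₀ →
                     SubstitutesAt a (a ∷ᶠ w) (a ∷ᶠ w′) (exts σ) (suc x₀)
SubstitutesAt-exts h zero    _    d = refl
SubstitutesAt-exts {a} {w} {σ = σ} h (suc y) y≢sx₀ d =
  trans (count-rename a (a ∷ᶠ w) suc (σ y) d) (h y (y≢sx₀ ∘ cong suc) d)

count-subst-node : ∀ (A X Y X′ Y′ O P C : Profile) c d →
  (X ⊕ c · O) d ≡ (X′ ⊕ O ⋆ C) d → (Y ⊕ c · P) d ≡ (Y′ ⊕ P ⋆ C) d →
  (A ⊕ (X ⊕ Y) ⊕ c · (O ⊕ P)) d ≡ (A ⊕ (X′ ⊕ Y′) ⊕ (O ⊕ P) ⋆ C) d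
count-subst-node A X Y X′ Y′ O P C c d e₁ e₂ = begin
  (A d + (X d + Y d)) + c * (O d + P d)
    ≡⟨ distribute (A d) c (X d) (Y d) (O d) (P d) ⟩
  A d + ((X d + c * O d) + (Y d + c * P d))
    ≡⟨ cong (A d +_) (cong₂ _+_ e₁ e₂) ⟩
  A d + ((X′ d + (O ⋆ C) d) + (Y′ d + (P ⋆ C) d))
    ≡⟨ regroup (A d) (X′ d) ((O ⋆ C) d) (Y′ d) ((P ⋆ C) d) ⟩
  (A d + (X′ d + Y′ d)) + ((O ⋆ C) d + (P ⋆ C) d)
    ≡⟨ cong (A d + (X′ d + Y′ d) +_) (sym (⋆-distribʳ-⊕ O P C d)) ⟩
  (A d + (X′ d + Y′ d)) + ((O ⊕ P) ⋆ C) d ∎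
  where
  open ≡-Reasoning
  distribute : ∀ i c x y o p → (i + (x + y)) + c * (o + p) ≡ i + ((x + c * o) + (y + c * p))
  distribute = solve-∀
  regroup : ∀ i x q y r → i + ((x + q) + (y + r)) ≡ (i + (x + y)) + (q + r)
  regroup = solve-∀

-- An occurrence of x₀ at depth e is replaced by a copy of σ x₀ pushed e levels down, whence
-- the convolution.  The weight of the replaced occurrences sits on the left so that no
-- subtraction occurs.
count-subst : ∀ a t {w w′ σ x₀} → SubstitutesAt a w w′ σ x₀ →
  count a w (subst σ t) ⊕ w′ x₀ · occAt x₀ t ≗ count a w′ t ⊕ occAt x₀ t ⋆ count a w (σ x₀)
count-subst-binder : ∀ a t {w w′ σ x₀} → SubstitutesAt a w w′ σ x₀ →
  count a (a ∷ᶠ w) (subst (exts σ) t) ⊕ w′ x₀ · occAt (suc x₀) t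
    ≗ count a (a ∷ᶠ w′) t ⊕ occAt (suc x₀) t ⋆ count a w (σ x₀)

count-subst a (var y) {w} {w′} {σ} {x₀} h d with y ≟ x₀
... | yes refl rewrite δ-self y = begin
  count a w (σ y) d + w′ y * [ 1 ]₀ d
    ≡⟨ cong (count a w (σ y) d +_) (·-[1] (w′ y) d) ⟩
  count a w (σ y) d + [ w′ y ]₀ d
    ≡⟨ +-comm (count a w (σ y) d) _ ⟩
  [ w′ y ]₀ d + count a w (σ y) d
    ≡⟨ cong ([ w′ y ]₀ d +_) (sym ([1]-⋆ (count a w (σ y)) d)) ⟩
  [ w′ y ]₀ d + ([ 1 ]₀ ⋆ count a w (σ y)) d ∎
  where open ≡-Reasoning
... | no y≢x₀ rewrite δ-other (y≢x₀ ∘ sym) = begin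
  count a w (σ y) d + w′ x₀ * [ 0 ]₀ d
    ≡⟨ cong (λ n → count a w (σ y) d + w′ x₀ * n) ([0]≗0ᶠ d) ⟩
  count a w (σ y) d + w′ x₀ * 0
    ≡⟨ trans (cong (count a w (σ y) d +_) (*-zeroʳ (w′ x₀))) (+-identityʳ _) ⟩
  count a w (σ y) d
    ≡⟨ h y y≢x₀ d ⟩
  [ w′ y ]₀ d
    ≡⟨ sym (+-identityʳ _) ⟩
  [ w′ y ]₀ d + 0
    ≡⟨ cong ([ w′ y ]₀ d +_) (sym ([]-⋆ 0 (count a w (σ x₀)) d)) ⟩
  [ w′ y ]₀ d + ([ 0 ]₀ ⋆ count a w (σ x₀)) d ∎
  where open ≡-Reasoning
count-subst a (lam t) {w} {w′} {σ} {x₀} h d = begin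
  ([ a ]₀ d + count a (a ∷ᶠ w) (subst (exts σ) t) d) + w′ x₀ * occAt (suc x₀) t d
    ≡⟨ +-assoc ([ a ]₀ d) _ _ ⟩
  [ a ]₀ d + (count a (a ∷ᶠ w) (subst (exts σ) t) d + w′ x₀ * occAt (suc x₀) t d)
    ≡⟨ cong ([ a ]₀ d +_) (count-subst-binder a t h d) ⟩
  [ a ]₀ d + (count a (a ∷ᶠ w′) t d + (occAt (suc x₀) t ⋆ count a w (σ x₀)) d)
    ≡⟨ sym (+-assoc ([ a ]₀ d) _ _) ⟩
  ([ a ]₀ d + count a (a ∷ᶠ w′) t d) + (occAt (suc x₀) t ⋆ count a w (σ x₀)) d ∎
  where open ≡-Reasoning
count-subst a (app t u) {w} {w′} {σ} {x₀} h d =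
  count-subst-node [ a ]₀ (count a w (subst σ t)) (count a w (subst σ u))
    (count a w′ t) (count a w′ u) (occAt x₀ t) (occAt x₀ u) (count a w (σ x₀)) (w′ x₀) d
    (count-subst a t h d) (count-subst a u h d)
count-subst a (bang t) {w′ = w′} {x₀ = x₀} h zero    = cong (a +_) (*-zeroʳ (w′ x₀))
count-subst a (bang t)                     h (suc d) = count-subst a t h d
count-subst a (letb u t) {w} {w′} {σ} {x₀} h d =
  count-subst-node [ a ]₀ (count a w (subst σ u)) (count a (a ∷ᶠ w) (subst (exts σ) t))
    (count a w′ u) (count a (a ∷ᶠ w′) t) (occAt x₀ u) (occAt (suc x₀) t)
    (count a w (σ x₀)) (w′ x₀) d
    (count-subst a u h d) (count-subst-binder a t h d)

count-subst-binder a t {w} {w′} {σ} {x₀} h d =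
  trans (count-subst a t (SubstitutesAt-exts h) d)
        (cong (count a (a ∷ᶠ w′) t d +_)
              (⋆-cong (λ _ → refl) (count-rename a (a ∷ᶠ w) suc (σ x₀)) d))

count-subst₀ : ∀ a w c t u →
  count a w (t [ u ]) ⊕ c · occAt 0 t ≗ count a (c ∷ᶠ w) t ⊕ occAt 0 t ⋆ count a w u
count-subst₀ a w c t u = count-subst a t substitutes
  where
  substitutes : SubstitutesAt a w (c ∷ᶠ w) (sub0 u) 0
  substitutes zero    0≢0 = contradiction refl 0≢0
  substitutes (suc y) _   d = refl

occAt-subst₀ : ∀ x t u → occAt x (t [ u ]) ≗ occAt (suc x) t ⊕ occAt 0 t ⋆ occAt x u
occAt-subst₀ x t u d = begin
  occAt x (t [ u ]) d
    ≡⟨ occAt-as-count x (t [ u ]) d ⟩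
  count 0 (δ x) (t [ u ]) d
    ≡⟨ sym (+-identityʳ _) ⟩
  count 0 (δ x) (t [ u ]) d + 0 * occAt 0 t d
    ≡⟨ count-subst₀ 0 (δ x) 0 t u d ⟩
  count 0 (0 ∷ᶠ δ x) t d + (occAt 0 t ⋆ count 0 (δ x) u) d
    ≡⟨ sym (cong₂ _+_ (occAt-suc-as-count x t d) (⋆-cong (λ _ → refl) (occAt-as-count x u) d)) ⟩
  occAt (suc x) t d + (occAt 0 t ⋆ occAt x u) d ∎
  where open ≡-Reasoning

-- exts σ introduces no occurrence of 0 other than its own, so the substitution lemma applies
-- at x₀ = 1 whatever σ is, and the convolution term vanishes.
occAt-0-exts : ∀ σ t → occAt 0 (subst (exts σ) t) ≗ occAt 0 t
occAt-0-exts σ t d = begin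
  occAt 0 (subst (exts σ) t) d
    ≡⟨ occAt-as-count 0 (subst (exts σ) t) d ⟩
  count 0 (δ 0) (subst (exts σ) t) d
    ≡⟨ sym (+-identityʳ _) ⟩
  count 0 (δ 0) (subst (exts σ) t) d + 0 * occAt 1 t d
    ≡⟨ count-subst 0 t substitutes d ⟩
  count 0 (δ 0) t d + (occAt 1 t ⋆ count 0 (δ 0) (exts σ 1)) d
    ≡⟨ cong (count 0 (δ 0) t d +_)
            (trans (⋆-cong (λ _ → refl) (no-0 (σ 0)) d) (⋆-zeroʳ (occAt 1 t) d)) ⟩
  count 0 (δ 0) t d + 0
    ≡⟨ +-identityʳ _ ⟩
  count 0 (δ 0) t d
    ≡⟨ sym (occAt-as-count 0 t d) ⟩
  occAt 0 t d ∎
  where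
  open ≡-Reasoning
  no-0 : ∀ s → count 0 (δ 0) (rename suc s) ≗ 0ᶠ
  no-0 s d = trans (count-rename 0 (δ 0) suc s d) (count-zero (λ _ → refl) s d)
  substitutes : SubstitutesAt 0 (δ 0) (δ 0) (exts σ) 1
  substitutes zero          _   d = refl
  substitutes (suc zero)    1≢1 d = contradiction refl 1≢1
  substitutes (suc (suc y)) _   d = trans (no-0 (σ (suc y)) d) (sym ([0]≗0ᶠ d))

occAt-rename : ∀ {x x′} ρ → (∀ y → δ x (ρ y) ≡ δ x′ y) →
               ∀ t → occAt x (rename ρ t) ≗ occAt x′ t
occAt-rename {x} {x′} ρ δ-ρ t d = begin
  occAt x (rename ρ t) d        ≡⟨ occAt-as-count x (rename ρ t) d ⟩
  count 0 (δ x) (rename ρ t) d  ≡⟨ count-rename 0 (δ x) ρ t d ⟩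
  count 0 (δ x ∘ ρ) t d         ≡⟨ count-cong 0 δ-ρ t d ⟩
  count 0 (δ x′) t d            ≡⟨ sym (occAt-as-count x′ t d) ⟩
  occAt x′ t d                  ∎
  where open ≡-Reasoning

occAt-rename-avoiding : ∀ {x} ρ → (∀ y → δ x (ρ y) ≡ 0) → ∀ t → occAt x (rename ρ t) ≗ 0ᶠ
occAt-rename-avoiding {x} ρ δ-ρ t d = begin
  occAt x (rename ρ t) d        ≡⟨ occAt-as-count x (rename ρ t) d ⟩
  count 0 (δ x) (rename ρ t) d  ≡⟨ count-rename 0 (δ x) ρ t d ⟩
  count 0 (δ x ∘ ρ) t d         ≡⟨ count-zero δ-ρ t d ⟩
  0                             ∎
  where open ≡-Reasoning

-- Stratified terms

Shallow : Profile → Set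
Shallow f = ∀ d → f (suc d) ≡ 0

BoxedOnce : Profile → Set
BoxedOnce f = f ≗ 0 ∷ᶠ [ 1 ]₀

LamBindable : Profile → Set
LamBindable f = f 0 ≤ 1 × Shallow f

LetBindable : Profile → Set
LetBindable f = Shallow f ⊎ BoxedOnce f

Shallow-resp : ∀ {f g} → f ≗ g → Shallow f → Shallow g
Shallow-resp f≗g sf d = trans (sym (f≗g (suc d))) (sf d)

BoxedOnce-resp : ∀ {f g} → f ≗ g → BoxedOnce f → BoxedOnce g
BoxedOnce-resp f≗g bf d = trans (sym (f≗g d)) (bf d)

LamBindable-resp : ∀ {f g} → f ≗ g → LamBindable f → LamBindable g
LamBindable-resp {f} {g} f≗g (f0≤1 , sf) =
  ≤-trans (≤-reflexive (sym (f≗g 0))) f0≤1 , Shallow-resp {f} {g} f≗g sf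

LetBindable-resp : ∀ {f g} → f ≗ g → LetBindable f → LetBindable g
LetBindable-resp f≗g (inj₁ sf) = inj₁ (Shallow-resp f≗g sf)
LetBindable-resp f≗g (inj₂ bf) = inj₂ (BoxedOnce-resp f≗g bf)

LetBindable-⊕-0ᶠ : ∀ {f g} → LetBindable f → g ≗ 0ᶠ → LetBindable (f ⊕ g)
LetBindable-⊕-0ᶠ {f} lf g≗0 =
  LetBindable-resp (λ d → sym (trans (cong (f d +_) (g≗0 d)) (+-identityʳ (f d)))) lf

LetBindable-0ᶠ-⊕ : ∀ {f g} → f ≗ 0ᶠ → LetBindable g → LetBindable (f ⊕ g)
LetBindable-0ᶠ-⊕ {f} {g} f≗0 = LetBindable-resp (λ d → cong (_+ g d) (sym (f≗0 d)))

Shallow⇒≗[]₀ : ∀ {f} → Shallow f → f ≗ [ f 0 ]₀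
Shallow⇒≗[]₀ sf zero    = refl
Shallow⇒≗[]₀ sf (suc d) = sf d

⋆-shallow : ∀ {f} → Shallow f → ∀ g → f ⋆ g ≗ f 0 · g
⋆-shallow {f} sf g d = trans (⋆-cong (Shallow⇒≗[]₀ sf) (λ _ → refl) d) ([]-⋆ (f 0) g d)

⋆-lamBindable-≤ : ∀ {f} → LamBindable f → ∀ g d → (f ⋆ g) d ≤ g d
⋆-lamBindable-≤ {f} (f0≤1 , sf) g d = begin
  (f ⋆ g) d   ≡⟨ ⋆-shallow sf g d ⟩
  f 0 * g d   ≤⟨ *-monoˡ-≤ (g d) f0≤1 ⟩
  1 * g d     ≡⟨ *-identityˡ (g d) ⟩
  g d         ∎
  where open ≤-Reasoning

⋆-boxedOnce : ∀ {f} → BoxedOnce f → ∀ g → f ⋆ g ≗ 0 ∷ᶠ g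
⋆-boxedOnce bf g zero    = ⋆-cong {g = g} bf (λ _ → refl) zero
⋆-boxedOnce bf g (suc d) = trans (⋆-cong {g = g} bf (λ _ → refl) (suc d)) ([1]-⋆ g d)

below-boxedOnce⇒LetBindable : ∀ {g} → (∀ d → g d ≤ (0 ∷ᶠ [ 1 ]₀) d) → LetBindable g
below-boxedOnce⇒LetBindable {g} g≤ with n≤1⇒n≡0∨n≡1 (g≤ 1)
... | inj₁ g1≡0 = inj₁ shallow
  where
  shallow : Shallow g
  shallow zero    = g1≡0
  shallow (suc d) = n≤0⇒n≡0 (g≤ (suc (suc d)))
... | inj₂ g1≡1 = inj₂ boxed
  where
  boxed : BoxedOnce g
  boxed zero          = n≤0⇒n≡0 (g≤ 0)
  boxed (suc zero)    = g1≡1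
  boxed (suc (suc d)) = n≤0⇒n≡0 (g≤ (suc (suc d)))

LetBindable-box : ∀ {g} → Shallow g → g 0 ≤ 1 → LetBindable (0 ∷ᶠ g)
LetBindable-box {g} sg g0≤1 = below-boxedOnce⇒LetBindable below
  where
  below : ∀ d → (0 ∷ᶠ g) d ≤ (0 ∷ᶠ [ 1 ]₀) d
  below zero          = z≤n
  below (suc zero)    = g0≤1
  below (suc (suc d)) = ≤-reflexive (sg d)

BoxedOnce-⊕ : ∀ {f g} → BoxedOnce (f ⊕ g) → (f ≗ 0ᶠ × BoxedOnce g) ⊎ (BoxedOnce f × g ≗ 0ᶠ)
BoxedOnce-⊕ {f} {g} b with n≤1⇒n≡0∨n≡1 (≤-trans (m≤m+n (f 1) (g 1)) (≤-reflexive (b 1)))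
... | inj₁ f1≡0 = inj₁ (f≗0 , λ d → trans (cong (_+ g d) (sym (f≗0 d))) (b d))
  where
  f≗0 : f ≗ 0ᶠ
  f≗0 zero          = m+n≡0⇒m≡0 (f 0) (b 0)
  f≗0 (suc zero)    = f1≡0
  f≗0 (suc (suc d)) = m+n≡0⇒m≡0 (f (suc (suc d))) (b (suc (suc d)))
... | inj₂ f1≡1 = inj₂ ((λ d → trans (sym (f+g≡f d)) (b d)) , g≗0)
  where
  g≗0 : g ≗ 0ᶠ
  g≗0 zero          = m+n≡0⇒n≡0 (f 0) (b 0)
  g≗0 (suc zero)    = suc-injective (trans (cong (_+ g 1) (sym f1≡1)) (b 1))
  g≗0 (suc (suc d)) = m+n≡0⇒n≡0 (f (suc (suc d))) (b (suc (suc d)))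
  f+g≡f : ∀ d → f d + g d ≡ f d
  f+g≡f d = trans (cong (f d +_) (g≗0 d)) (+-identityʳ (f d))

-- The clause g 0 ≤ f 0 is what makes ↝ compatible with sums (↝-⊕).
infix 4 _↝_

_↝_ : Profile → Profile → Set
f ↝ g = (Shallow f → Shallow g × g 0 ≤ f 0) × (BoxedOnce f → LetBindable g)

↝-LamBindable : ∀ {f g} → f ↝ g → LamBindable f → LamBindable g
↝-LamBindable (shallow , _) (f0≤1 , sf) = let (sg , g0≤f0) = shallow sf in ≤-trans g0≤f0 f0≤1 , sg

↝-LetBindable : ∀ {f g} → f ↝ g → LetBindable f → LetBindable g
↝-LetBindable (shallow , _)     (inj₁ sf) = inj₁ (proj₁ (shallow sf))
↝-LetBindable (_       , boxed) (inj₂ bf) = boxed bf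

↝-trans : ∀ {f g h} → f ↝ g → g ↝ h → f ↝ h
↝-trans {f} {g} {h} f↝g g↝h = shallow , boxed
  where
  shallow : Shallow f → Shallow h × h 0 ≤ f 0
  shallow sf = let (sg , g0≤f0) = proj₁ f↝g sf
                   (sh , h0≤g0) = proj₁ g↝h sg
               in sh , ≤-trans h0≤g0 g0≤f0
  boxed : BoxedOnce f → LetBindable h
  boxed bf = ↝-LetBindable g↝h (proj₂ f↝g bf)

↝-pointwise : ∀ {f g} → (∀ d → g d ≤ f d) → f ↝ g
↝-pointwise {f} {g} g≤f = shallow , boxed
  where
  shallow : Shallow f → Shallow g × g 0 ≤ f 0
  shallow sf = (λ d → n≤0⇒n≡0 (≤-trans (g≤f (suc d)) (≤-reflexive (sf d)))) , g≤f 0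
  boxed : BoxedOnce f → LetBindable g
  boxed bf = below-boxedOnce⇒LetBindable (λ d → ≤-trans (g≤f d) (≤-reflexive (bf d)))

↝-reflexive : ∀ {f g} → g ≗ f → f ↝ g
↝-reflexive g≗f = ↝-pointwise (λ d → ≤-reflexive (g≗f d))

↝-refl : ∀ {f} → f ↝ f
↝-refl = ↝-reflexive (λ _ → refl)

↝-0ᶠ : ∀ {f g} → f ↝ g → f ≗ 0ᶠ → g ≗ 0ᶠ
↝-0ᶠ {f} {g} f↝g f≗0 = g≗0
  where
  shallow : Shallow g × g 0 ≤ f 0
  shallow = proj₁ f↝g (f≗0 ∘ suc)
  g≗0 : g ≗ 0ᶠ
  g≗0 zero    = n≤0⇒n≡0 (≤-trans (proj₂ shallow) (≤-reflexive (f≗0 0)))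
  g≗0 (suc d) = proj₁ shallow d

↝-⊕ : ∀ {f f′ g g′} → f ↝ f′ → g ↝ g′ → f ⊕ g ↝ f′ ⊕ g′
↝-⊕ {f} {f′} {g} {g′} f↝f′ g↝g′ = shallow , boxed
  where
  shallow : Shallow (f ⊕ g) → Shallow (f′ ⊕ g′) × f′ 0 + g′ 0 ≤ f 0 + g 0
  shallow s = let (sf′ , f′0≤f0) = proj₁ f↝f′ (λ d → m+n≡0⇒m≡0 (f (suc d)) (s d))
                  (sg′ , g′0≤g0) = proj₁ g↝g′ (λ d → m+n≡0⇒n≡0 (f (suc d)) (s d))
              in (λ d → cong₂ _+_ (sf′ d) (sg′ d)) , +-mono-≤ f′0≤f0 g′0≤g0
  boxed : BoxedOnce (f ⊕ g) → LetBindable (f′ ⊕ g′)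
  boxed b with BoxedOnce-⊕ b
  ... | inj₁ (f≗0 , bg) = LetBindable-0ᶠ-⊕ (↝-0ᶠ f↝f′ f≗0) (proj₂ g↝g′ bg)
  ... | inj₂ (bf , g≗0) = LetBindable-⊕-0ᶠ (proj₂ f↝f′ bf) (↝-0ᶠ g↝g′ g≗0)

↝-box : ∀ {f g} → f ↝ g → 0 ∷ᶠ f ↝ 0 ∷ᶠ g
↝-box {f} {g} f↝g = shallow , boxed
  where
  shallow : Shallow (0 ∷ᶠ f) → Shallow (0 ∷ᶠ g) × 0 ≤ 0
  shallow s = ↝-0ᶠ f↝g s , z≤n
  boxed : BoxedOnce (0 ∷ᶠ f) → LetBindable (0 ∷ᶠ g)
  boxed b = let (sg , g0≤f0) = proj₁ f↝g (b ∘ suc ∘ suc)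
            in LetBindable-box sg (≤-trans g0≤f0 (≤-reflexive (b 1)))

↝-unbox : ∀ c g → 0 ∷ᶠ g ↝ c · g
↝-unbox c g = shallow , boxed
  where
  shallow : Shallow (0 ∷ᶠ g) → Shallow (c · g) × c * g 0 ≤ 0
  shallow s = (λ d → trans (cong (c *_) (s (suc d))) (*-zeroʳ c)) ,
              ≤-reflexive (trans (cong (c *_) (s 0)) (*-zeroʳ c))
  boxed : BoxedOnce (0 ∷ᶠ g) → LetBindable (c · g)
  boxed b = inj₁ (λ d → trans (cong (c *_) (b (suc (suc d)))) (*-zeroʳ c))

data Stratified : Tm → Set where
  var  : ∀ x → Stratified (var x)
  lam  : ∀ {t} → Stratified t → LamBindable (occAt 0 t) → Stratified (lam t)
  app  : ∀ {t u} → Stratified t → Stratified u → Stratified (app t u)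
  bang : ∀ {t} → Stratified t → Stratified (bang t)
  letb : ∀ {u t} → Stratified u → Stratified t → LetBindable (occAt 0 t) → Stratified (letb u t)

δ0-ext : ∀ ρ y → δ 0 (ext ρ y) ≡ δ 0 y
δ0-ext ρ zero    = refl
δ0-ext ρ (suc y) = refl

Stratified-rename : ∀ ρ {t} → Stratified t → Stratified (rename ρ t)
Stratified-rename ρ (var x)         = var (ρ x)
Stratified-rename ρ (lam {t} st ok) =
  lam (Stratified-rename (ext ρ) st) (LamBindable-resp (sym ∘ occAt-rename (ext ρ) (δ0-ext ρ) t) ok)
Stratified-rename ρ (app st su)     = app (Stratified-rename ρ st) (Stratified-rename ρ su)
Stratified-rename ρ (bang st)       = bang (Stratified-rename ρ st)
Stratified-rename ρ (letb {t = t} su st ok) =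
  letb (Stratified-rename ρ su) (Stratified-rename (ext ρ) st)
       (LetBindable-resp (sym ∘ occAt-rename (ext ρ) (δ0-ext ρ) t) ok)

Stratified-exts : ∀ {σ} → (∀ y → Stratified (σ y)) → ∀ y → Stratified (exts σ y)
Stratified-exts sσ zero    = var 0
Stratified-exts sσ (suc y) = Stratified-rename suc (sσ y)

Stratified-subst : ∀ {σ t} → (∀ y → Stratified (σ y)) → Stratified t → Stratified (subst σ t)
Stratified-subst sσ (var x)             = sσ x
Stratified-subst {σ} sσ (lam {t} st ok) =
  lam (Stratified-subst (Stratified-exts sσ) st) (LamBindable-resp (sym ∘ occAt-0-exts σ t) ok)
Stratified-subst sσ (app st su)         = app (Stratified-subst sσ st) (Stratified-subst sσ su)
Stratified-subst sσ (bang st)           = bang (Stratified-subst sσ st)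
Stratified-subst {σ} sσ (letb {t = t} su st ok) =
  letb (Stratified-subst sσ su) (Stratified-subst (Stratified-exts sσ) st)
       (LetBindable-resp (sym ∘ occAt-0-exts σ t) ok)

Stratified-subst₀ : ∀ {t u} → Stratified t → Stratified u → Stratified (t [ u ])
Stratified-subst₀ {u = u} st su = Stratified-subst sub0-stratified st
  where
  sub0-stratified : ∀ y → Stratified (sub0 u y)
  sub0-stratified zero    = su
  sub0-stratified (suc y) = var y

occAt-↝ : ∀ {s s′} → Stratified s → s ⟶ s′ → ∀ x → occAt x s ↝ occAt x s′
occAt-↝ (app (lam _ ok) _) (β {t} {u}) x = ↝-pointwise below
  where
  below : ∀ d → occAt x (t [ u ]) d ≤ occAt (suc x) t d + occAt x u d
  below d = ≤-trans (≤-reflexive (occAt-subst₀ x t u d))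
                    (+-monoʳ-≤ (occAt (suc x) t d) (⋆-lamBindable-≤ ok (occAt x u) d))
occAt-↝ (letb _ _ (inj₂ boxed)) (bangr {u} {t}) x = ↝-reflexive unchanged
  where
  unchanged : ∀ d → occAt x (t [ u ]) d ≡ (0 ∷ᶠ occAt x u) d + occAt (suc x) t d
  unchanged d = trans (occAt-subst₀ x t u d)
    (trans (cong (occAt (suc x) t d +_) (⋆-boxedOnce boxed (occAt x u) d)) (+-comm (occAt (suc x) t d) _))
occAt-↝ (letb _ _ (inj₁ shallow)) (bangr {u} {t}) x =
  ↝-trans (↝-⊕ (↝-unbox (occAt 0 t 0) (occAt x u)) ↝-refl) (↝-reflexive unboxed)
  where
  unboxed : ∀ d → occAt x (t [ u ]) d ≡ occAt 0 t 0 * occAt x u d + occAt (suc x) t d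
  unboxed d = trans (occAt-subst₀ x t u d)
    (trans (cong (occAt (suc x) t d +_) (⋆-shallow shallow (occAt x u) d)) (+-comm (occAt (suc x) t d) _))
occAt-↝ _ (com1 {t₁} {t₂} {t₃}) x = ↝-reflexive reassociate
  where
  δ-ext-suc : ∀ y → δ (suc (suc x)) (ext suc y) ≡ δ (suc x) y
  δ-ext-suc zero    = refl
  δ-ext-suc (suc y) = δ-suc (suc x) (suc (suc y))
  reassociate : ∀ d → occAt x t₁ d + (occAt (suc x) t₂ d + occAt (suc (suc x)) (rename (ext suc) t₃) d)
                    ≡ (occAt x t₁ d + occAt (suc x) t₂ d) + occAt (suc x) t₃ d
  reassociate d = trans (cong (λ n → occAt x t₁ d + (occAt (suc x) t₂ d + n))
                              (occAt-rename (ext suc) δ-ext-suc t₃ d))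
                        (sym (+-assoc (occAt x t₁ d) _ _))
occAt-↝ _ (com2 {t₁} {t₂} {t₃}) x = ↝-reflexive reassociate
  where
  reassociate : ∀ d → occAt x t₁ d + (occAt (suc x) t₂ d + occAt (suc x) (rename suc t₃) d)
                    ≡ (occAt x t₁ d + occAt (suc x) t₂ d) + occAt x t₃ d
  reassociate d = trans (cong (λ n → occAt x t₁ d + (occAt (suc x) t₂ d + n))
                              (occAt-rename suc (δ-suc x ∘ suc) t₃ d))
                        (sym (+-assoc (occAt x t₁ d) _ _))
occAt-↝ (lam st _)    (ξlam r)  x = occAt-↝ st r (suc x)
occAt-↝ (app st _)    (ξappl r) x = ↝-⊕ (occAt-↝ st r x) ↝-refl
occAt-↝ (app _ su)    (ξappr r) x = ↝-⊕ ↝-refl (occAt-↝ su r x)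
occAt-↝ (bang st)     (ξbang r) x = ↝-box (occAt-↝ st r x)
occAt-↝ (letb su _ _) (ξletl r) x = ↝-⊕ (occAt-↝ su r x) ↝-refl
occAt-↝ (letb _ st _) (ξletr r) x = ↝-⊕ ↝-refl (occAt-↝ st r (suc x))

Stratified-step : ∀ {s s′} → Stratified s → s ⟶ s′ → Stratified s′
Stratified-step (app (lam st _) su)   β     = Stratified-subst₀ st su
Stratified-step (letb (bang su) st _) bangr = Stratified-subst₀ st su
Stratified-step (letb (letb s₁ s₂ ok₂) s₃ ok₃) (com1 {t₃ = t₃}) =
  letb s₁ (letb s₂ (Stratified-rename (ext suc) s₃)
                   (LetBindable-resp (sym ∘ occAt-rename (ext suc) (δ0-ext suc) t₃) ok₃))
       (LetBindable-⊕-0ᶠ ok₂ (occAt-rename-avoiding (ext suc) δ1-ext-suc t₃))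
  where
  δ1-ext-suc : ∀ y → δ 1 (ext suc y) ≡ 0
  δ1-ext-suc zero    = refl
  δ1-ext-suc (suc y) = δ-suc 0 (suc (suc y))
Stratified-step (app (letb s₁ s₂ ok₂) s₃) (com2 {t₃ = t₃}) =
  letb s₁ (app s₂ (Stratified-rename suc s₃))
       (LetBindable-⊕-0ᶠ ok₂ (occAt-rename-avoiding suc (λ _ → refl) t₃))
Stratified-step (lam st ok)     (ξlam r)  = lam (Stratified-step st r) (↝-LamBindable (occAt-↝ st r 0) ok)
Stratified-step (app st su)     (ξappl r) = app (Stratified-step st r) su
Stratified-step (app st su)     (ξappr r) = app st (Stratified-step su r)
Stratified-step (bang st)       (ξbang r) = bang (Stratified-step st r)
Stratified-step (letb su st ok) (ξletl r) = letb (Stratified-step su r) st ok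
Stratified-step (letb su st ok) (ξletr r) =
  letb su (Stratified-step st r) (↝-LetBindable (occAt-↝ st r 0) ok)

-- Terms are stratified

occAt≤occ : ∀ x t d → occAt x t d ≤ occ x t
occAt≤occ x (var y)    zero    = ≤-refl
occAt≤occ x (var y)    (suc d) = z≤n
occAt≤occ x (lam t)    d       = occAt≤occ (suc x) t d
occAt≤occ x (app t u)  d       = +-mono-≤ (occAt≤occ x t d) (occAt≤occ x u d)
occAt≤occ x (bang t)   zero    = z≤n
occAt≤occ x (bang t)   (suc d) = occAt≤occ x t d
occAt≤occ x (letb u t) d       = +-mono-≤ (occAt≤occ x u d) (occAt≤occ (suc x) t d)

∉FV⇒occAt≗0ᶠ : ∀ x t → ¬ (x ∈FV t) → occAt x t ≗ 0ᶠ
∉FV⇒occAt≗0ᶠ x t x∉t d = n≤0⇒n≡0 (≤-trans (occAt≤occ x t d) (≮⇒≥ x∉t))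

∉TV⇒Shallow : ∀ {t} → IsTerm t → ∀ x → ¬ (x ∈TV t) → Shallow (occAt x t)
∉TV⇒Shallow (var y)           x _  d = refl
∉TV⇒Shallow (lam ⊢t _ _)      x x∉ d = ∉TV⇒Shallow ⊢t (suc x) x∉ d
∉TV⇒Shallow (app ⊢t ⊢u _ _)   x x∉ d =
  cong₂ _+_ (∉TV⇒Shallow ⊢t x (x∉ ∘ inj₁) d) (∉TV⇒Shallow ⊢u x (x∉ ∘ inj₂) d)
∉TV⇒Shallow (bang {t} ⊢t _ _) x x∉ d = ∉FV⇒occAt≗0ᶠ x t x∉ d
∉TV⇒Shallow (letb ⊢u ⊢t _ _)  x x∉ d =
  cong₂ _+_ (∉TV⇒Shallow ⊢u x (x∉ ∘ inj₁) d) (∉TV⇒Shallow ⊢t (suc x) (x∉ ∘ inj₂) d)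

∈TV⇒LetBindable : ∀ {t} → IsTerm t → ∀ x → x ∈TV t → LetBindable (occAt x t)
∈TV⇒LetBindable (lam ⊢t _ _) x x∈ = ∈TV⇒LetBindable ⊢t (suc x) x∈
∈TV⇒LetBindable (app {t₂ = u} ⊢t _ tv∩fv _) x (inj₁ x∈) =
  LetBindable-⊕-0ᶠ (∈TV⇒LetBindable ⊢t x x∈) (∉FV⇒occAt≗0ᶠ x u (tv∩fv x x∈))
∈TV⇒LetBindable (app {t} _ ⊢u _ fv∩tv) x (inj₂ x∈) =
  LetBindable-0ᶠ-⊕ (∉FV⇒occAt≗0ᶠ x t (λ x∈FV → fv∩tv x x∈FV x∈))
                   (∈TV⇒LetBindable ⊢u x x∈)
∈TV⇒LetBindable (bang {t} ⊢t no-tv linear) x x∈ =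
  LetBindable-box (∉TV⇒Shallow ⊢t x (no-tv x))
                  (≤-trans (occAt≤occ x t 0) (≤-reflexive (linear x x∈)))
∈TV⇒LetBindable (letb {t₂ = t} ⊢u _ tv∩fv _) x (inj₁ x∈) =
  LetBindable-⊕-0ᶠ (∈TV⇒LetBindable ⊢u x x∈) (∉FV⇒occAt≗0ᶠ (suc x) t (tv∩fv x x∈))
∈TV⇒LetBindable (letb {u} _ ⊢t _ fv∩tv) x (inj₂ x∈) =
  LetBindable-0ᶠ-⊕ (∉FV⇒occAt≗0ᶠ x u (λ x∈FV → fv∩tv x x∈FV x∈))
                   (∈TV⇒LetBindable ⊢t (suc x) x∈)

_∈TV?_ : ∀ x t → Dec (x ∈TV t)
x ∈TV? var y    = no (λ ())
x ∈TV? lam t    = suc x ∈TV? t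
x ∈TV? app t u  = (x ∈TV? t) ⊎-dec (x ∈TV? u)
x ∈TV? bang t   = 0 <? occ x t
x ∈TV? letb u t = (x ∈TV? u) ⊎-dec (suc x ∈TV? t)

IsTerm⇒Stratified : ∀ {t} → IsTerm t → Stratified t
IsTerm⇒Stratified (var x)                = var x
IsTerm⇒Stratified (lam {t} ⊢t 0∉ occ≤1) =
  lam (IsTerm⇒Stratified ⊢t) (≤-trans (occAt≤occ 0 t 0) occ≤1 , ∉TV⇒Shallow ⊢t 0 0∉)
IsTerm⇒Stratified (app ⊢t ⊢u _ _)        = app (IsTerm⇒Stratified ⊢t) (IsTerm⇒Stratified ⊢u)
IsTerm⇒Stratified (bang ⊢t _ _)          = bang (IsTerm⇒Stratified ⊢t)
IsTerm⇒Stratified (letb {t₂ = t} ⊢u ⊢t _ _) =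
  letb (IsTerm⇒Stratified ⊢u) (IsTerm⇒Stratified ⊢t) let-bindable
  where
  let-bindable : LetBindable (occAt 0 t)
  let-bindable with 0 ∈TV? t
  ... | yes 0∈ = ∈TV⇒LetBindable ⊢t 0 0∈
  ... | no 0∉  = inj₁ (∉TV⇒Shallow ⊢t 0 0∉)

-- The measure

lamAt : ℕ → ℕ → ℕ
lamAt zero    m = suc m
lamAt (suc d) m = [ 1 ]₀ d + m

appAt : ℕ → ℕ → ℕ → ℕ
appAt zero    m n = suc (m + m + n)
appAt (suc d) m n = [ 1 ]₀ d + (m + n)

-- μ t 0 is the weight that decreases under the commutations; μ t (suc d) is the number of
-- nodes of t at box depth d.
μ : Tm → ℕ → ℕ
μ (var x)    zero          = 1
μ (var x)    (suc d)       = [ 1 ]₀ d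
μ (lam t)    j             = lamAt j (μ t j)
μ (app t u)  j             = appAt j (μ t j) (μ u j)
μ (bang t)   zero          = suc (μ t 0)
μ (bang t)   (suc zero)    = 1
μ (bang t)   (suc (suc d)) = μ t (suc d)
μ (letb u t) j             = appAt j (μ u j) (μ t j)

size : Tm → Profile
size t d = μ t (suc d)

size-as-count : ∀ t → size t ≗ count 1 (const 1) t
size-as-count (var x)    d       = refl
size-as-count (lam t)    d       =
  cong ([ 1 ]₀ d +_) (trans (size-as-count t d) (count-cong 1 (const-∷ᶠ 1) t d))
size-as-count (app t u)  d       =
  cong ([ 1 ]₀ d +_) (cong₂ _+_ (size-as-count t d) (size-as-count u d))
size-as-count (bang t)   zero    = refl
size-as-count (bang t)   (suc d) = size-as-count t d
size-as-count (letb u t) d       = cong ([ 1 ]₀ d +_)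
  (cong₂ _+_ (size-as-count u d) (trans (size-as-count t d) (count-cong 1 (const-∷ᶠ 1) t d)))

size-subst₀ : ∀ t u → size (t [ u ]) ⊕ occAt 0 t ≗ size t ⊕ occAt 0 t ⋆ size u
size-subst₀ t u d = begin
  size (t [ u ]) d + occAt 0 t d
    ≡⟨ cong₂ _+_ (size-as-count (t [ u ]) d) (sym (*-identityˡ (occAt 0 t d))) ⟩
  count 1 (const 1) (t [ u ]) d + 1 * occAt 0 t d
    ≡⟨ count-subst₀ 1 (const 1) 1 t u d ⟩
  count 1 (1 ∷ᶠ const 1) t d + (occAt 0 t ⋆ count 1 (const 1) u) d
    ≡⟨ sym (cong₂ _+_ (trans (size-as-count t d) (count-cong 1 (const-∷ᶠ 1) t d))
                      (⋆-cong (λ _ → refl) (size-as-count u) d)) ⟩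
  size t d + (occAt 0 t ⋆ size u) d ∎
  where open ≡-Reasoning

size-subst-≤ : ∀ t u d → size (t [ u ]) d ≤ size t d + (occAt 0 t ⋆ size u) d
size-subst-≤ t u d = ≤-trans (m≤m+n _ (occAt 0 t d)) (≤-reflexive (size-subst₀ t u d))

μ-rename : ∀ ρ t j → μ (rename ρ t) j ≡ μ t j
μ-rename ρ (var x)    zero          = refl
μ-rename ρ (var x)    (suc d)       = refl
μ-rename ρ (lam t)    j             = cong (lamAt j) (μ-rename (ext ρ) t j)
μ-rename ρ (app t u)  j             = cong₂ (appAt j) (μ-rename ρ t j) (μ-rename ρ u j)
μ-rename ρ (bang t)   zero          = cong suc (μ-rename ρ t 0)
μ-rename ρ (bang t)   (suc zero)    = refl
μ-rename ρ (bang t)   (suc (suc d)) = μ-rename ρ t (suc d)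
μ-rename ρ (letb u t) j             = cong₂ (appAt j) (μ-rename ρ u j) (μ-rename (ext ρ) t j)

depth : Tm → ℕ
depth (var _)    = 0
depth (lam t)    = depth t
depth (app t u)  = depth t ⊔ depth u
depth (bang t)   = suc (depth t)
depth (letb u t) = depth u ⊔ depth t

VanishesFrom : ℕ → (ℕ → ℕ) → Set
VanishesFrom D f = ∀ j → D ≤ j → f j ≡ 0

size-vanishes : ∀ t → VanishesFrom (suc (depth t)) (size t)
size-vanishes (var x)    (suc d) _         = refl
size-vanishes (lam t)    (suc d) d>t       = size-vanishes t (suc d) d>t
size-vanishes (app t u)  (suc d) d>tu      = cong₂ _+_
  (size-vanishes t (suc d) (m⊔n<o⇒m<o _ _ d>tu)) (size-vanishes u (suc d) (m⊔n<o⇒n<o _ _ d>tu))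
size-vanishes (bang t)   (suc d) (s≤s d>t) = size-vanishes t d d>t
size-vanishes (letb u t) (suc d) d>ut      = cong₂ _+_
  (size-vanishes u (suc d) (m⊔n<o⇒m<o _ _ d>ut)) (size-vanishes t (suc d) (m⊔n<o⇒n<o _ _ d>ut))

μ-vanishes : ∀ t → VanishesFrom (2 + depth t) (μ t)
μ-vanishes t (suc d) (s≤s d>t) = size-vanishes t d d>t

size-pos : ∀ t → 0 < size t 0
size-pos (var x)    = s≤s z≤n
size-pos (lam t)    = s≤s z≤n
size-pos (app t u)  = s≤s z≤n
size-pos (bang t)   = s≤s z≤n
size-pos (letb u t) = s≤s z≤n

lastPositive : ∀ D {f} → VanishesFrom D f → 0 < f 0 → ∃[ m ] 0 < f m × VanishesFrom (suc m) f
lastPositive zero        vanish f0>0 = contradiction (vanish 0 z≤n) (>⇒≢ f0>0)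
lastPositive (suc D) {f} vanish f0>0 with f D ≟ 0
... | no fD≢0  = D , n≢0⇒n>0 fD≢0 , vanish
... | yes fD≡0 = lastPositive D vanish′ f0>0
  where
  vanish′ : VanishesFrom D f
  vanish′ j D≤j with m≤n⇒m<n∨m≡n D≤j
  ... | inj₁ D<j  = vanish j D<j
  ... | inj₂ refl = fD≡0

infix 4 _≺_

_≺_ : (ℕ → ℕ) → (ℕ → ℕ) → Set
g ≺ f = ∃[ k ] g k < f k × (∀ j → k < j → g j ≤ f j)

<-mono⇒≤-mono : ∀ {F : ℕ → ℕ} → F Preserves _<_ ⟶ _<_ → F Preserves _≤_ ⟶ _≤_
<-mono⇒≤-mono F-mono m≤n with m≤n⇒m<n∨m≡n m≤n
... | inj₁ m<n  = <⇒≤ (F-mono m<n)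
... | inj₂ refl = ≤-refl

≺-map : ∀ (F : ℕ → ℕ → ℕ) → (∀ j → F j Preserves _<_ ⟶ _<_) →
        ∀ {f g} → g ≺ f → (λ j → F j (g j)) ≺ (λ j → F j (f j))
≺-map F F-mono (k , gk<fk , above) =
  k , F-mono k gk<fk , λ j k<j → <-mono⇒≤-mono (F-mono j) (above j k<j)

lamAt-mono : ∀ j → lamAt j Preserves _<_ ⟶ _<_
lamAt-mono zero    m<n = s≤s m<n
lamAt-mono (suc d) m<n = +-monoʳ-< ([ 1 ]₀ d) m<n

appAt-monoˡ : ∀ j n → (λ m → appAt j m n) Preserves _<_ ⟶ _<_
appAt-monoˡ zero    n m<m′ = s≤s (+-monoˡ-< n (+-mono-< m<m′ m<m′))
appAt-monoˡ (suc d) n m<m′ = +-monoʳ-< ([ 1 ]₀ d) (+-monoˡ-< n m<m′)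

appAt-monoʳ : ∀ j m → appAt j m Preserves _<_ ⟶ _<_
appAt-monoʳ zero    m n<n′ = s≤s (+-monoʳ-< (m + m) n<n′)
appAt-monoʳ (suc d) m n<n′ = +-monoʳ-< ([ 1 ]₀ d) (+-monoʳ-< m n<n′)

≺-lamAt : ∀ {f g} → g ≺ f → (λ j → lamAt j (g j)) ≺ (λ j → lamAt j (f j))
≺-lamAt = ≺-map lamAt lamAt-mono

≺-appAtˡ : ∀ (h : ℕ → ℕ) {f g} → g ≺ f →
           (λ j → appAt j (g j) (h j)) ≺ (λ j → appAt j (f j) (h j))
≺-appAtˡ h = ≺-map (λ j m → appAt j m (h j)) (λ j → appAt-monoˡ j (h j))

≺-appAtʳ : ∀ (h : ℕ → ℕ) {f g} → g ≺ f →
           (λ j → appAt j (h j) (g j)) ≺ (λ j → appAt j (h j) (f j))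
≺-appAtʳ h = ≺-map (λ j → appAt j (h j)) (λ j → appAt-monoʳ j (h j))

≺-bang : ∀ {s s′} → μ s′ ≺ μ s → μ (bang s′) ≺ μ (bang s)
≺-bang {s} {s′} (zero , lt , above) = zero , s≤s lt , bang-above
  where
  bang-above : ∀ j → 0 < j → μ (bang s′) j ≤ μ (bang s) j
  bang-above (suc zero)    _ = ≤-refl
  bang-above (suc (suc d)) _ = above (suc d) (s≤s z≤n)
≺-bang {s} {s′} (suc k , lt , above) = suc (suc k) , lt , bang-above
  where
  bang-above : ∀ j → suc (suc k) < j → μ (bang s′) j ≤ μ (bang s) j
  bang-above (suc (suc d)) (s≤s (s≤s k<d)) = above (suc d) (s≤s k<d)

μ-β : ∀ {t u} → LamBindable (occAt 0 t) → μ (t [ u ]) ≺ μ (app (lam t) u)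
μ-β {t} {u} ok = 1 , s≤s (≤-trans (size-β 0) (+-monoˡ-≤ (size u 0) (n≤1+n _))) , above
  where
  size-β : ∀ d → size (t [ u ]) d ≤ size t d + size u d
  size-β d = ≤-trans (size-subst-≤ t u d) (+-monoʳ-≤ (size t d) (⋆-lamBindable-≤ ok (size u) d))
  above : ∀ j → 1 < j → μ (t [ u ]) j ≤ μ (app (lam t) u) j
  above (suc zero)    (s≤s ())
  above (suc (suc d)) _ = size-β (suc d)

-- u stays at its depth; only the occurrence of the variable, at depth 1, disappears.
μ-bang-boxed : ∀ {t u} → BoxedOnce (occAt 0 t) → μ (t [ u ]) ≺ μ (letb (bang u) t)
μ-bang-boxed {t} {u} boxed = 2 , ≤-reflexive one-fewer , above
  where
  unboxed : ∀ d → size (t [ u ]) (suc d) + occAt 0 t (suc d) ≡ size u d + size t (suc d)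
  unboxed d = trans (size-subst₀ t u (suc d))
    (trans (cong (size t (suc d) +_) (⋆-boxedOnce boxed (size u) (suc d))) (+-comm (size t (suc d)) _))
  one-fewer : suc (size (t [ u ]) 1) ≡ size u 0 + size t 1
  one-fewer = trans (+-comm 1 _) (trans (cong (size (t [ u ]) 1 +_) (sym (boxed 1))) (unboxed 0))
  above : ∀ j → 2 < j → μ (t [ u ]) j ≤ μ (letb (bang u) t) j
  above (suc zero)          (s≤s ())
  above (suc (suc zero))    (s≤s (s≤s ()))
  above (suc (suc (suc d))) _ = ≤-trans (m≤m+n _ _) (≤-reflexive (unboxed (suc d)))

-- The contents of the box move one level up, in occAt 0 t 0 copies: the deepest level they
-- occupied, depth m + 1 of the redex, loses size u m nodes and nothing deeper changes.
μ-bang-shallow : ∀ {t u} → Shallow (occAt 0 t) → μ (t [ u ]) ≺ μ (letb (bang u) t)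
μ-bang-shallow {t} {u} shallow with lastPositive (suc (depth u)) (size-vanishes u) (size-pos u)
... | m , u-m>0 , u-vanishes =
  suc (suc m) , ≤-<-trans (size-beyond (suc m) ≤-refl) (m<n+m _ u-m>0) , above
  where
  copies = occAt 0 t 0
  size-beyond : ∀ d → m < d → size (t [ u ]) d ≤ size t d
  size-beyond d m<d = begin
    size (t [ u ]) d                   ≤⟨ size-subst-≤ t u d ⟩
    size t d + (occAt 0 t ⋆ size u) d  ≡⟨ cong (size t d +_) (⋆-shallow shallow (size u) d) ⟩
    size t d + copies * size u d       ≡⟨ cong (λ n → size t d + copies * n) (u-vanishes d m<d) ⟩
    size t d + copies * 0              ≡⟨ trans (cong (size t d +_) (*-zeroʳ copies)) (+-identityʳ _) ⟩
    size t d                           ∎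
    where open ≤-Reasoning
  above : ∀ j → suc (suc m) < j → μ (t [ u ]) j ≤ μ (letb (bang u) t) j
  above (suc (suc d)) (s≤s (s≤s m<d)) = ≤-trans (size-beyond (suc d) (m<n⇒m<1+n m<d)) (m≤n+m _ _)

μ-commute : ∀ (f g h h′ : ℕ → ℕ) → h′ ≗ h →
  (λ j → appAt j (f j) (appAt j (g j) (h′ j))) ≺ (λ j → appAt j (appAt j (f j) (g j)) (h j))
μ-commute f g h h′ h′≗h = 0 , weight-drops , above
  where
  regroup : ∀ a b c → suc (suc (a + a + suc (b + b + c))) + (a + a)
                    ≡ suc (suc (a + a + b) + suc (a + a + b) + c)
  regroup = solve-∀
  reassociate : ∀ i a b c → i + (a + (i + (b + c))) ≡ i + ((i + (a + b)) + c)
  reassociate = solve-∀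
  weight-drops : appAt 0 (f 0) (appAt 0 (g 0) (h′ 0)) < appAt 0 (appAt 0 (f 0) (g 0)) (h 0)
  weight-drops rewrite h′≗h 0 = ≤-trans (m≤m+n _ (f 0 + f 0)) (≤-reflexive (regroup (f 0) (g 0) (h 0)))
  above : ∀ j → 0 < j → appAt j (f j) (appAt j (g j) (h′ j)) ≤ appAt j (appAt j (f j) (g j)) (h j)
  above (suc d) _ rewrite h′≗h (suc d) =
    ≤-reflexive (reassociate ([ 1 ]₀ d) (f (suc d)) (g (suc d)) (h (suc d)))

μ-decreases : ∀ {s s′} → Stratified s → s ⟶ s′ → μ s′ ≺ μ s
μ-decreases (app (lam _ ok) _)        (β {t} {u})     = μ-β {t} {u} ok
μ-decreases (letb _ _ (inj₁ shallow)) (bangr {u} {t}) = μ-bang-shallow {t} {u} shallow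
μ-decreases (letb _ _ (inj₂ boxed))   (bangr {u} {t}) = μ-bang-boxed {t} {u} boxed
μ-decreases _ (com1 {t₁} {t₂} {t₃}) = μ-commute (μ t₁) (μ t₂) (μ t₃) _ (μ-rename (ext suc) t₃)
μ-decreases _ (com2 {t₁} {t₂} {t₃}) = μ-commute (μ t₁) (μ t₂) (μ t₃) _ (μ-rename suc t₃)
μ-decreases (lam s _)        (ξlam r)          = ≺-lamAt (μ-decreases s r)
μ-decreases (app s _)        (ξappl {u = u} r) = ≺-appAtˡ (μ u) (μ-decreases s r)
μ-decreases (app {t} _ s)    (ξappr r)         = ≺-appAtʳ (μ t) (μ-decreases s r)
μ-decreases (bang s)         (ξbang r)         = ≺-bang (μ-decreases s r)
μ-decreases (letb s _ _)     (ξletl {t = t} r) = ≺-appAtˡ (μ t) (μ-decreases s r)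
μ-decreases (letb {u} _ s _) (ξletr r)         = ≺-appAtʳ (μ u) (μ-decreases s r)

-- Lexicographic descent

≺-below : ∀ {D f g} → VanishesFrom D f → (g≺f : g ≺ f) → proj₁ g≺f < D
≺-below {D} vanish (k , gk<fk , _) with D ≤? k
... | yes D≤k = contradiction (vanish k D≤k) (>⇒≢ (≤-<-trans z≤n gk<fk))
... | no D≰k  = ≰⇒> D≰k

≺-VanishesFrom : ∀ {D f g} → VanishesFrom D f → g ≺ f → VanishesFrom D g
≺-VanishesFrom vanish g≺f@(k , _ , above) j D≤j =
  n≤0⇒n≡0 (≤-trans (above j (<-≤-trans (≺-below vanish g≺f) D≤j)) (≤-reflexive (vanish j D≤j)))

window : ∀ D → (ℕ → ℕ) → Vec ℕ D
window zero    f = []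
window (suc D) f = f D ∷ window D f

≺⇒Lex-< : ∀ {D f g} → VanishesFrom D f → g ≺ f → Lex-< _≡_ _<_ (window D g) (window D f)
≺⇒Lex-< {D} {f} {g} vanish g≺f@(k , gk<fk , above) = lex D (≺-below vanish g≺f)
  where
  lex : ∀ D → k < D → Lex-< _≡_ _<_ (window D g) (window D f)
  lex (suc D) (s≤s k≤D) with m≤n⇒m<n∨m≡n k≤D
  ... | inj₂ refl = this gk<fk refl
  ... | inj₁ k<D with m≤n⇒m<n∨m≡n (above D k<D)
  ...   | inj₁ gD<fD = this gD<fD refl
  ...   | inj₂ gD≡fD = next gD≡fD (lex D k<D)

noInfiniteDescent : ∀ {A : Set} {_<_ : A → A → Set} →
                    WellFounded _<_ → ∀ xs → ¬ InfiniteDescendingSequence _<_ xs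
noInfiniteDescent {_<_ = _<_} wf xs descending =
  descent∧wf⇒empty descent wf (xs 0) (xs , refl , descending)
  where
  descent : Descent _<_ (λ x → ∃[ ys ] InfiniteDescendingSequenceFrom _<_ ys x)
  descent (ys , refl , ys-descending) = ys 1 , ys-descending 0 , ys ∘ suc , refl , ys-descending ∘ suc

mainTheorem2 : ∀ t → IsTerm t → ¬ InfiniteReductionFrom t
mainTheorem2 t ⊢t (ts , refl , steps) =
  noInfiniteDescent (<-wellFounded trans (proj₁ <-resp₂-≡) <-wellFounded-ℕ)
                    (window D ∘ μ ∘ ts) descending
  where
  D = 2 + depth (ts 0)
  stratified : ∀ n → Stratified (ts n)
  stratified zero    = IsTerm⇒Stratified ⊢t
  stratified (suc n) = Stratified-step (stratified n) (steps n)
  decreasing : ∀ n → μ (ts (suc n)) ≺ μ (ts n)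
  decreasing n = μ-decreases (stratified n) (steps n)
  vanishing : ∀ n → VanishesFrom D (μ (ts n))
  vanishing zero    = μ-vanishes (ts 0)
  vanishing (suc n) = ≺-VanishesFrom (vanishing n) (decreasing n)
  descending : InfiniteDescendingSequence (Lex-< _≡_ _<_) (window D ∘ μ ∘ ts)
  descending n = ≺⇒Lex-< (vanishing n) (decreasing n)
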